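{- Let $a,b$ be integers with $a-1>b\ge 1$, let $\varphi(0)=0^a1$, $\varphi(1)=0^b1$, let $u_\beta=\lim_{n\to\infty}\varphi^n(0)$, let $T(w)=0^b1\varphi(w)0^b$, and define $U^{(1)}=0^{a-1}$, $U^{(n)}=T(U^{(n-1)})$, $V^{(1)}=0^b$, $V^{(n)}=T(V^{(n-1)})$ for $n\ge 2$. (i) If $b$ is even and $a$ odd, then for all $n\in\mathbb N$, $V^{(n)}$ is a central factor of $U^{(n)}$; moreover $U^{(2n-1)}$ has center $\varepsilon$ and $U^{(2n)}$ has center $1$. (ii) If $a$ and $b$ are both even, then $U^{(1)}=0^{a-1}$ is the only maximal palindrome with center $0$; for all $n\in\mathbb N$, $V^{(n)}$ is a central factor of $U^{(n+1)}$; moreover $U^{(2n)}$ has center $\varepsilon$ and $U^{(2n+1)}$ has center $1$. (iii) If $b$ is odd and $a$ even, then for all $n\in\mathbb N$, $V^{(n)}$ is a central factor of $U^{(n)}$; moreover $U^{(3n-2)}$ has center $0$, $U^{(3n-1)}$ has center $\varepsilon$, and $U^{(3n)}$ has center $1$. (iv) If $a$ and $b$ are both odd, then the only maximal palindrome with center $\varepsilon$ is $U^{(1)}=0^{a-1}$, the only maximal palindrome with center $1$ is $U^{(2)}$, and for $n\ge 3$, $U^{(n)}$ has center $0$ and central factor $V^{(n-2)}$.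
   Context: Here $\mathbb N$ denotes the positive integers. A palindrome is a word equal to its reversal $\overline w$. A palindrome $p$ occurring in $u_\beta$ is maximal if neither $0p0$ nor $1p1$ is a factor of $u_\beta$ (the maximal palindromes of $u_\beta$ are exactly the $U^{(n)}$). A palindrome $q$ is a central factor of a palindrome $p$ if $p=wq\overline{w}$ for a finite factor $w$ of $u_\beta$. The center of an odd-length palindrome $p$ is the letter $z$ with $p=wz\overline w$; the center of an even-length palindrome is the empty word $\varepsilon$. -}

module Defs where

open import Data.Nat using (ℕ; zero; suc; _+_; _∸_)
open import Data.List using (List; []; _∷_; _++_; replicate; concatMap; reverse; map; upTo; length)
open import Data.Product using (Σ; ∃; _×_)
open import Relation.Binary.PropositionalEquality using (_≡_)
open import Relation.Nullary using (¬_)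

data Letter : Set where
  𝟎 𝟏 : Letter

Word : Set
Word = List Letter

φ-letter : ℕ → ℕ → Letter → Word
φ-letter a b 𝟎 = replicate a 𝟎 ++ (𝟏 ∷ [])
φ-letter a b 𝟏 = replicate b 𝟎 ++ (𝟏 ∷ [])

φ : ℕ → ℕ → Word → Word
φ a b = concatMap (φ-letter a b)

φ^ : ℕ → ℕ → ℕ → Word → Word
φ^ a b zero    w = w
φ^ a b (suc n) w = φ a b (φ^ a b n w)

-- k-th letter of a finite word (default 𝟎 if out of range; never used
-- out of range below).
at : Word → ℕ → Letter
at []      _       = 𝟎
at (x ∷ w) zero    = x
at (x ∷ w) (suc k) = at w k

-- u_β = lim φ^n(0): since φ(0) starts with 0, φ^n(0) is a prefix of
-- φ^(n+1)(0), and |φ^(k+1)(0)| > k (as a ≥ 1), so the k-th letter of the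
-- limit is the k-th letter of φ^(k+1)(0).
uβ : ℕ → ℕ → ℕ → Letter
uβ a b k = at (φ^ a b (suc k) (𝟎 ∷ [])) k

Factor : ℕ → ℕ → Word → Set
Factor a b w = ∃ λ i → w ≡ map (λ j → uβ a b (i + j)) (upTo (length w))

Palindrome : Word → Set
Palindrome w = reverse w ≡ w

MaximalPalindrome : ℕ → ℕ → Word → Set
MaximalPalindrome a b p =
  Palindrome p × Factor a b p ×
  ¬ Factor a b (𝟎 ∷ p ++ (𝟎 ∷ [])) × ¬ Factor a b (𝟏 ∷ p ++ (𝟏 ∷ []))

CentralFactor : ℕ → ℕ → Word → Word → Set
CentralFactor a b q p = ∃ λ w → Factor a b w × p ≡ w ++ q ++ reverse w

-- p has center c, where c is ε = [] or a single letter z = z ∷ [].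
HasCenter : Word → Word → Set
HasCenter p c = ∃ λ w → p ≡ w ++ c ++ reverse w

ε : Word
ε = []

T : ℕ → ℕ → Word → Word
T a b w = replicate b 𝟎 ++ (𝟏 ∷ φ a b w) ++ replicate b 𝟎

-- U n = U^(n), V n = V^(n) for n ≥ 1; the value at n = 0 is an unused dummy.
U : ℕ → ℕ → ℕ → Word
U a b zero = []
U a b (suc zero) = replicate (a ∸ 1) 𝟎
U a b (suc (suc n)) = T a b (U a b (suc n))

V : ℕ → ℕ → ℕ → Word
V a b zero = []
V a b (suc zero) = replicate b 𝟎
V a b (suc (suc n)) = T a b (V a b (suc n))

{-# OPTIONS --safe #-}
module Submission where

-- Every maximal palindrome of u_β is one of the U⁽ⁿ⁾.  A maximal palindrome made of zeros is
-- 0^(a-1), because 0^(a+1) is not a factor while 1 0^a 1 is.  Otherwise it reads 0^i 1 r, and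
-- desubstituting along φ gives r = φ(t) 0^i with t a palindromic factor; maximality forces i = b,
-- so the palindrome is T(t), and t is again maximal because z T(t) z is a factor exactly when
-- z t z is.  Induction on the length yields some U⁽ⁿ⁾, and conversely every U⁽ⁿ⁾ is maximal.
--
-- T transports centres: if p = w q w̄ then T(p) has central factor T(q).  Since T(ε) = 0^b 1 0^b
-- and T(z) = 0^b 1 0^κ(z) 1 0^b with κ(0) = a, κ(1) = b, a palindrome with centre ε is sent to one
-- with centre 1, and one with centre z to one whose centre is that of 0^κ(z), i.e. ε or 0 according
-- to the parity of κ(z).  Starting from U⁽¹⁾ = 0^(a-1) this gives the periodic patterns of centres
-- in the four parity cases.  A word has at most one centre of length ≤ 1, so a maximal palindrome
-- with a given centre is the unique U⁽ⁿ⁾ carrying it.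

open import Defs
open import Data.Nat using (ℕ; zero; suc; _+_; _*_; _∸_; _≤_; _<_; z≤n; s≤s; _≟_)
open import Data.Nat.Properties
open import Data.Nat.Divisibility using (_∣_; divides; ∣m+n∣m⇒∣n; ∣m∣n⇒∣m+n; ∣-refl; _∣0; ∣1⇒≡1)
open import Data.Nat.Solver using (module +-*-Solver)
open import Data.List using (List; []; _∷_; _++_; _∷ʳ_; replicate; reverse; length; map; upTo; applyUpTo)
open import Data.List.Properties
  using (∷-injectiveˡ; ∷-injectiveʳ; ++-assoc; ++-identityʳ; ++-cancelʳ; ++-conicalʳ; ++-monoid;
         concatMap-++; reverse-++; unfold-reverse; length-++; length-reverse; length-replicate; length-++-≤ˡ; map-upTo)
open import Data.Product using (∃; ∃₂; _×_; _,_; proj₁; proj₂; map₁)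
open import Data.Sum using (_⊎_; inj₁; inj₂)
open import Data.Empty using (⊥; ⊥-elim)
open import Relation.Binary.PropositionalEquality
open import Relation.Nullary using (¬_; contradiction; yes; no)
open import Relation.Binary.Definitions using (Tri; tri<; tri≈; tri>)
open import Induction.WellFounded using (Acc; acc)
open import Data.Nat.Induction using (<-wellFounded)
open import Function.Bundles using (_⇔_; mk⇔; Equivalence)
open import Algebra.Solver.Monoid (++-monoid Letter) using (_⊕_; _⊜_) renaming (solve to ++-solve)

open ≡-Reasoning

infix 8 𝟎^_

𝟎^_ : ℕ → Word
𝟎^ n = replicate n 𝟎

wrap : Letter → Word → Word
wrap z p = z ∷ p ++ z ∷ []

𝟎≢𝟏 : 𝟎 ≢ 𝟏
𝟎≢𝟏 ()

𝟎^-+ : ∀ m n → 𝟎^ (m + n) ≡ 𝟎^ m ++ 𝟎^ n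
𝟎^-+ zero    n = refl
𝟎^-+ (suc m) n = cong (𝟎 ∷_) (𝟎^-+ m n)

𝟎^-∷ʳ : ∀ n → 𝟎^ n ∷ʳ 𝟎 ≡ 𝟎 ∷ 𝟎^ n
𝟎^-∷ʳ zero    = refl
𝟎^-∷ʳ (suc n) = cong (𝟎 ∷_) (𝟎^-∷ʳ n)

reverse-𝟎^ : ∀ n → reverse (𝟎^ n) ≡ 𝟎^ n
reverse-𝟎^ zero    = refl
reverse-𝟎^ (suc n) = begin
  reverse (𝟎^ suc n)  ≡⟨ unfold-reverse 𝟎 (𝟎^ n) ⟩
  reverse (𝟎^ n) ∷ʳ 𝟎 ≡⟨ cong (_∷ʳ 𝟎) (reverse-𝟎^ n) ⟩
  𝟎^ n ∷ʳ 𝟎           ≡⟨ 𝟎^-∷ʳ n ⟩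
  𝟎^ suc n            ∎

𝟎^𝟏-injective : ∀ j l {q r} → 𝟎^ j ++ 𝟏 ∷ q ≡ 𝟎^ l ++ 𝟏 ∷ r → j ≡ l × q ≡ r
𝟎^𝟏-injective zero    zero    refl = refl , refl
𝟎^𝟏-injective (suc j) (suc l) e    = map₁ (cong suc) (𝟎^𝟏-injective j l (∷-injectiveʳ e))

𝟎^-prefix-≤ : ∀ n l {r q} → 𝟎^ n ++ r ≡ 𝟎^ l ++ 𝟏 ∷ q → n ≤ l
𝟎^-prefix-≤ zero    l       e = z≤n
𝟎^-prefix-≤ (suc n) (suc l) e = s≤s (𝟎^-prefix-≤ n l (∷-injectiveʳ e))

𝟎^-view : ∀ p → (∃ λ i → p ≡ 𝟎^ i) ⊎ (∃₂ λ i r → p ≡ 𝟎^ i ++ 𝟏 ∷ r)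
𝟎^-view []      = inj₁ (0 , refl)
𝟎^-view (𝟏 ∷ p) = inj₂ (0 , p , refl)
𝟎^-view (𝟎 ∷ p) with 𝟎^-view p
... | inj₁ (i , e)     = inj₁ (suc i , cong (𝟎 ∷_) e)
... | inj₂ (i , r , e) = inj₂ (suc i , r , cong (𝟎 ∷_) e)

++-split-𝟎^𝟏 : ∀ l x {z q} → x ++ z ≡ 𝟎^ l ++ 𝟏 ∷ q →
    (∃₂ λ i j → x ≡ 𝟎^ i × z ≡ 𝟎^ j ++ 𝟏 ∷ q × i + j ≡ l)
  ⊎ (∃ λ x′ → x ≡ 𝟎^ l ++ 𝟏 ∷ x′ × x′ ++ z ≡ q)
++-split-𝟎^𝟏 l       []      e = inj₁ (0 , l , refl , e , refl)
++-split-𝟎^𝟏 zero    (𝟏 ∷ x) e = inj₂ (x , refl , ∷-injectiveʳ e)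
++-split-𝟎^𝟏 (suc l) (𝟎 ∷ x) e with ++-split-𝟎^𝟏 l x (∷-injectiveʳ e)
... | inj₁ (i , j , x≡ , z≡ , i+j≡l) = inj₁ (suc i , j , cong (𝟎 ∷_) x≡ , z≡ , cong suc i+j≡l)
... | inj₂ (x′ , x≡ , q≡)            = inj₂ (x′ , cong (𝟎 ∷_) x≡ , q≡)

∷-as-∷ʳ : ∀ (x : Letter) xs → ∃₂ λ ys y → x ∷ xs ≡ ys ∷ʳ y
∷-as-∷ʳ x []       = [] , x , refl
∷-as-∷ʳ x (x′ ∷ xs) with ∷-as-∷ʳ x′ xs
... | ys , y , e = x ∷ ys , y , cong (x ∷_) e

++-cancel-equal-length : ∀ (x y : Word) {r s} → length x ≡ length y → x ++ r ≡ y ++ s → r ≡ s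
++-cancel-equal-length []      []      _ e = e
++-cancel-equal-length (_ ∷ x) (_ ∷ y) l e =
  ++-cancel-equal-length x y (suc-injective l) (∷-injectiveʳ e)

-- Factors and maximal palindromes

infix 4 _⊑_

_⊑_ : Word → Word → Set
w ⊑ v = ∃₂ λ x y → x ++ w ++ y ≡ v

⊑-refl : ∀ w → w ⊑ w
⊑-refl w = [] , [] , ++-identityʳ w

⊑-trans : ∀ {u v w} → u ⊑ v → v ⊑ w → u ⊑ w
⊑-trans {u} (x , y , refl) (x′ , y′ , refl) = x′ ++ x , y ++ y′ ,
  ++-solve 5 (λ x′ x u y y′ → (x′ ⊕ x) ⊕ (u ⊕ (y ⊕ y′)) ⊜ x′ ⊕ ((x ⊕ (u ⊕ y)) ⊕ y′)) refl x′ x u y y′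

⊑-infix : ∀ x w y → w ⊑ x ++ w ++ y
⊑-infix x w y = x , y , refl

⊑-prefix : ∀ w y → w ⊑ w ++ y
⊑-prefix w y = [] , y , refl

⊑-suffix : ∀ x w → w ⊑ x ++ w
⊑-suffix x w = x , [] , cong (x ++_) (++-identityʳ w)

⊑-length : ∀ {u v} → u ⊑ v → length u ≤ length v
⊑-length {u} (x , y , refl) rewrite length-++ x {u ++ y} | length-++ u {y} =
  ≤-trans (m≤m+n (length u) (length y)) (m≤n+m _ (length x))

𝟎^-mono-⊑ : ∀ {m n} → m ≤ n → 𝟎^ m ⊑ 𝟎^ n
𝟎^-mono-⊑ {m} m≤n with d , refl ← m≤n⇒∃[o]m+o≡n m≤n = [] , 𝟎^ d , sym (𝟎^-+ m d)

++-around-𝟏 : ∀ X x r Y → (X ++ x) ++ 𝟏 ∷ r ++ Y ≡ X ++ (x ++ 𝟏 ∷ r) ++ Y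
++-around-𝟏 X x r Y =
  ++-solve 5 (λ X x o r Y → (X ⊕ x) ⊕ (o ⊕ (r ⊕ Y)) ⊜ X ⊕ ((x ⊕ (o ⊕ r)) ⊕ Y)) refl X x (𝟏 ∷ []) r Y

𝟏-⋢-[𝟎] : ∀ x r → ¬ (x ++ 𝟏 ∷ r ⊑ 𝟎 ∷ [])
𝟏-⋢-[𝟎] x r (X , Y , e) = no-𝟏 (X ++ x) (trans (++-around-𝟏 X x r Y) e)
  where
  no-𝟏 : ∀ L {t} → L ++ 𝟏 ∷ t ≢ 𝟎 ∷ []
  no-𝟏 []      ()
  no-𝟏 (_ ∷ L) e with () ← ++-conicalʳ L _ (∷-injectiveʳ e)

𝟎^-pad-⊑ : ∀ {n K K′} M → n ≤ K → n ≤ K′ → 𝟎^ n ++ M ++ 𝟎^ n ⊑ 𝟎^ K ++ M ++ 𝟎^ K′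
𝟎^-pad-⊑ {n} M n≤K n≤K′ with d , refl ← m≤n⇒∃[o]m+o≡n n≤K | d′ , refl ← m≤n⇒∃[o]m+o≡n n≤K′ =
  𝟎^ d , 𝟎^ d′ , (begin
    𝟎^ d ++ (𝟎^ n ++ M ++ 𝟎^ n) ++ 𝟎^ d′
      ≡⟨ ++-solve 4 (λ d n M d′ → d ⊕ ((n ⊕ (M ⊕ n)) ⊕ d′) ⊜ (d ⊕ n) ⊕ (M ⊕ (n ⊕ d′))) refl (𝟎^ d) (𝟎^ n) M (𝟎^ d′) ⟩
    (𝟎^ d ++ 𝟎^ n) ++ M ++ 𝟎^ n ++ 𝟎^ d′
      ≡⟨ cong₂ (λ u v → u ++ M ++ v) (𝟎^-+ d n) (𝟎^-+ n d′) ⟨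
    𝟎^ (d + n) ++ M ++ 𝟎^ (n + d′)
      ≡⟨ cong (λ k → 𝟎^ k ++ M ++ 𝟎^ (n + d′)) (+-comm d n) ⟩
    𝟎^ (n + d) ++ M ++ 𝟎^ (n + d′) ∎)

wrap-𝟎^ : ∀ i M → wrap 𝟎 (𝟎^ i ++ M ++ 𝟎^ i) ≡ 𝟎^ suc i ++ M ++ 𝟎^ suc i
wrap-𝟎^ i M = cong (𝟎 ∷_) (begin
  (𝟎^ i ++ M ++ 𝟎^ i) ∷ʳ 𝟎
    ≡⟨ ++-solve 4 (λ z M n o → (z ⊕ (M ⊕ n)) ⊕ o ⊜ z ⊕ (M ⊕ (n ⊕ o))) refl (𝟎^ i) M (𝟎^ i) (𝟎 ∷ []) ⟩
  𝟎^ i ++ M ++ 𝟎^ i ∷ʳ 𝟎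
    ≡⟨ cong (λ u → 𝟎^ i ++ M ++ u) (𝟎^-∷ʳ i) ⟩
  𝟎^ i ++ M ++ 𝟎^ suc i ∎)

MaximalPalindromeIn : (Word → Set) → Word → Set
MaximalPalindromeIn L p = Palindrome p × L p × ¬ L (wrap 𝟎 p) × ¬ L (wrap 𝟏 p)

MaximalPalindromeIn-transport : ∀ {L L′ : Word → Set} {p} → (∀ {w} → L w → L′ w) → (∀ {w} → L′ w → L w) →
  MaximalPalindromeIn L p → MaximalPalindromeIn L′ p
MaximalPalindromeIn-transport L⇒L′ L′⇒L (pal , Lp , ¬L0p0 , ¬L1p1) =
  pal , L⇒L′ Lp , (λ L′0p0 → ¬L0p0 (L′⇒L L′0p0)) , (λ L′1p1 → ¬L1p1 (L′⇒L L′1p1))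

-- Centres

HasCenter-refl : ∀ p → HasCenter p p
HasCenter-refl p = [] , sym (++-identityʳ p)

𝟎^-pad-centre : ∀ n M → HasCenter (𝟎^ n ++ M ++ 𝟎^ n) M
𝟎^-pad-centre n M = 𝟎^ n , cong (λ u → 𝟎^ n ++ M ++ u) (sym (reverse-𝟎^ n))

HasCenter-trans : ∀ {p q r} → HasCenter p q → HasCenter q r → HasCenter p r
HasCenter-trans {r = r} (w , refl) (v , refl) = w ++ v , (begin
  w ++ (v ++ r ++ reverse v) ++ reverse w
    ≡⟨ ++-solve 5 (λ w v r v̄ w̄ → w ⊕ ((v ⊕ (r ⊕ v̄)) ⊕ w̄) ⊜ (w ⊕ v) ⊕ (r ⊕ (v̄ ⊕ w̄))) refl w v r (reverse v) (reverse w) ⟩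
  (w ++ v) ++ r ++ reverse v ++ reverse w
    ≡⟨ cong (λ u → (w ++ v) ++ r ++ u) (reverse-++ w v) ⟨
  (w ++ v) ++ r ++ reverse (w ++ v) ∎)

length-centred : ∀ (w c : Word) → length (w ++ c ++ reverse w) ≡ length c + 2 * length w
length-centred w c = begin
  length (w ++ c ++ reverse w)
    ≡⟨ length-++ w ⟩
  length w + length (c ++ reverse w)
    ≡⟨ cong (length w +_) (length-++ c) ⟩
  length w + (length c + length (reverse w))
    ≡⟨ cong (λ n → length w + (length c + n)) (length-reverse w) ⟩
  length w + (length c + length w)
    ≡⟨ solve 2 (λ m n → m :+ (n :+ m) := n :+ con 2 :* m) refl (length w) (length c) ⟩
  length c + 2 * length w ∎
  where open +-*-Solver

HasCenter-ε-letter : ∀ {p z} → HasCenter p ε → ¬ HasCenter p (z ∷ [])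
HasCenter-ε-letter {z = z} (w , refl) (v , e) =
  even≢odd (length w) (length v) (begin
    2 * length w                      ≡⟨ length-centred w ε ⟨
    length (w ++ ε ++ reverse w)      ≡⟨ cong length e ⟩
    length (v ++ z ∷ [] ++ reverse v) ≡⟨ length-centred v (z ∷ []) ⟩
    suc (2 * length v)                ∎)

HasCenter-letter-unique : ∀ {p x y} → HasCenter p (x ∷ []) → HasCenter p (y ∷ []) → x ≡ y
HasCenter-letter-unique {x = x} {y} (w , refl) (v , e) =
  ∷-injectiveˡ (++-cancel-equal-length w v |w|≡|v| e)
  where
  |w|≡|v| : length w ≡ length v
  |w|≡|v| = *-cancelˡ-≡ (length w) (length v) 2 (suc-injective (begin
    suc (2 * length w)                ≡⟨ length-centred w (x ∷ []) ⟨
    length (w ++ x ∷ [] ++ reverse w) ≡⟨ cong length e ⟩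
    length (v ++ y ∷ [] ++ reverse v) ≡⟨ length-centred v (y ∷ []) ⟩
    suc (2 * length v)                ∎))

parity : ∀ n → 2 ∣ n ⊎ 2 ∣ suc n
parity zero    = inj₁ (2 ∣0)
parity (suc n) with parity n
... | inj₁ 2∣n    = inj₂ (∣m∣n⇒∣m+n (∣-refl {2}) 2∣n)
... | inj₂ 2∣1+n  = inj₁ 2∣1+n

odd⇒2∣suc : ∀ {n} → ¬ 2 ∣ n → 2 ∣ suc n
odd⇒2∣suc {n} 2∤n with parity n
... | inj₁ 2∣n   = contradiction 2∣n 2∤n
... | inj₂ 2∣1+n = 2∣1+n

odd⇒2∣pred : ∀ {n} → ¬ 2 ∣ n → 2 ∣ n ∸ 1
odd⇒2∣pred {zero}  2∤n = contradiction (2 ∣0) 2∤n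
odd⇒2∣pred {suc n} 2∤n with parity n
... | inj₁ 2∣n   = 2∣n
... | inj₂ 2∣1+n = contradiction 2∣1+n 2∤n

∣-∸ : ∀ {d m n} → n ≤ m → d ∣ m → d ∣ n → d ∣ m ∸ n
∣-∸ {n = n} n≤m d∣m d∣n = ∣m+n∣m⇒∣n (subst (_ ∣_) (sym (m+[n∸m]≡n n≤m)) d∣m) d∣n

2∣n⇒2∤suc : ∀ {n} → 2 ∣ n → ¬ 2 ∣ suc n
2∣n⇒2∤suc {n} 2∣n 2∣1+n with () ← ∣1⇒≡1 (∣m+n∣m⇒∣n (subst (2 ∣_) (+-comm 1 n) 2∣1+n) 2∣n)

𝟎^-centre : ∀ {m n} → m ≤ n → 2 ∣ n ∸ m → HasCenter (𝟎^ n) (𝟎^ m)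
𝟎^-centre {m} {n} m≤n (divides q n∸m≡q*2) = 𝟎^ q , (begin
  𝟎^ n                          ≡⟨ cong 𝟎^_ n≡q+[m+q] ⟩
  𝟎^ (q + (m + q))              ≡⟨ 𝟎^-+ q (m + q) ⟩
  𝟎^ q ++ 𝟎^ (m + q)            ≡⟨ cong (𝟎^ q ++_) (𝟎^-+ m q) ⟩
  𝟎^ q ++ 𝟎^ m ++ 𝟎^ q          ≡⟨ cong (λ u → 𝟎^ q ++ 𝟎^ m ++ u) (reverse-𝟎^ q) ⟨
  𝟎^ q ++ 𝟎^ m ++ reverse (𝟎^ q) ∎)
  where
  open +-*-Solver
  n≡q+[m+q] : n ≡ q + (m + q)
  n≡q+[m+q] = begin
    n             ≡⟨ m∸n+n≡m m≤n ⟨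
    n ∸ m + m     ≡⟨ cong (_+ m) n∸m≡q*2 ⟩
    q * 2 + m     ≡⟨ solve 2 (λ q m → q :* con 2 :+ m := q :+ (m :+ q)) refl q m ⟩
    q + (m + q)   ∎

𝟎^-centre-even : ∀ {n} → 2 ∣ n → HasCenter (𝟎^ n) ε
𝟎^-centre-even 2∣n = 𝟎^-centre z≤n 2∣n

𝟎^-centre-odd : ∀ {n} → ¬ 2 ∣ n → HasCenter (𝟎^ n) (𝟎 ∷ [])
𝟎^-centre-odd {zero}  2∤n = contradiction (2 ∣0) 2∤n
𝟎^-centre-odd {suc n} 2∤n = 𝟎^-centre (s≤s z≤n) (odd⇒2∣pred 2∤n)

at-++ˡ : ∀ x y {j} → j < length x → at (x ++ y) j ≡ at x j
at-++ˡ (c ∷ x) y {zero}  _         = refl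
at-++ˡ (c ∷ x) y {suc j} (s≤s j<) = at-++ˡ x y j<

at-++ʳ : ∀ x y j → at (x ++ y) (length x + j) ≡ at y j
at-++ʳ []      y j = refl
at-++ʳ (c ∷ x) y j = at-++ʳ x y j

applyUpTo-cong : ∀ {f g : ℕ → Letter} n → (∀ {j} → j < n → f j ≡ g j) → applyUpTo f n ≡ applyUpTo g n
applyUpTo-cong zero    f≗g = refl
applyUpTo-cong (suc n) f≗g = cong₂ _∷_ (f≗g (s≤s z≤n)) (applyUpTo-cong n (λ j<n → f≗g (s≤s j<n)))

applyUpTo-at : ∀ w → applyUpTo (at w) (length w) ≡ w
applyUpTo-at []      = refl
applyUpTo-at (c ∷ w) = cong (c ∷_) (applyUpTo-at w)

applyUpTo-at-prefix : ∀ v n → n ≤ length v → ∃ λ y → applyUpTo (at v) n ++ y ≡ v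
applyUpTo-at-prefix v       zero    _        = v , refl
applyUpTo-at-prefix (c ∷ v) (suc n) (s≤s n≤) with y , e ← applyUpTo-at-prefix v n n≤ = y , cong (c ∷_) e

applyUpTo-at-⊑ : ∀ v i n → i + n ≤ length v → applyUpTo (λ j → at v (i + j)) n ⊑ v
applyUpTo-at-⊑ v       zero    n le with y , e ← applyUpTo-at-prefix v n le = [] , y , e
applyUpTo-at-⊑ (c ∷ v) (suc i) n (s≤s le) with x , y , e ← applyUpTo-at-⊑ v i n le = c ∷ x , y , cong (c ∷_) e

module Morphism (a b : ℕ) (b<a : b < a) where

  κ : Letter → ℕ
  κ 𝟎 = a
  κ 𝟏 = b

  κ-injective : ∀ x y → κ x ≡ κ y → x ≡ y
  κ-injective 𝟎 𝟎 _ = refl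
  κ-injective 𝟎 𝟏 a≡b = contradiction a≡b (>⇒≢ b<a)
  κ-injective 𝟏 𝟎 b≡a = contradiction b≡a (<⇒≢ b<a)
  κ-injective 𝟏 𝟏 _ = refl

  b≤κ : ∀ z → b ≤ κ z
  b≤κ 𝟎 = <⇒≤ b<a
  b≤κ 𝟏 = ≤-refl

  κ≤a : ∀ z → κ z ≤ a
  κ≤a 𝟎 = ≤-refl
  κ≤a 𝟏 = <⇒≤ b<a

  b<κ⇒𝟎 : ∀ z → b < κ z → z ≡ 𝟎
  b<κ⇒𝟎 𝟎 _   = refl
  b<κ⇒𝟎 𝟏 b<b = contradiction b<b (<-irrefl refl)

  Φ : Word → Word
  Φ = φ a b

  Φ-∷ : ∀ z s → Φ (z ∷ s) ≡ 𝟎^ κ z ++ 𝟏 ∷ Φ s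
  Φ-∷ 𝟎 s = ++-assoc (𝟎^ a) (𝟏 ∷ []) (Φ s)
  Φ-∷ 𝟏 s = ++-assoc (𝟎^ b) (𝟏 ∷ []) (Φ s)

  Φ-[_] : ∀ z → Φ (z ∷ []) ≡ 𝟎^ κ z ++ 𝟏 ∷ []
  Φ-[ z ] = Φ-∷ z []

  Φ-++ : ∀ x y → Φ (x ++ y) ≡ Φ x ++ Φ y
  Φ-++ = concatMap-++ (φ-letter a b)

  Φ-wrap : ∀ x t y → Φ (x ∷ t ++ y ∷ []) ≡ (𝟎^ κ x ++ 𝟏 ∷ Φ t ++ 𝟎^ κ y) ∷ʳ 𝟏
  Φ-wrap x t y = begin
    Φ (x ∷ t ++ y ∷ [])
      ≡⟨ Φ-∷ x (t ++ y ∷ []) ⟩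
    𝟎^ κ x ++ 𝟏 ∷ Φ (t ++ y ∷ [])
      ≡⟨ cong (λ u → 𝟎^ κ x ++ 𝟏 ∷ u) (Φ-++ t (y ∷ [])) ⟩
    𝟎^ κ x ++ 𝟏 ∷ Φ t ++ Φ (y ∷ [])
      ≡⟨ cong (λ u → 𝟎^ κ x ++ 𝟏 ∷ Φ t ++ u) Φ-[ y ] ⟩
    𝟎^ κ x ++ 𝟏 ∷ Φ t ++ 𝟎^ κ y ++ 𝟏 ∷ []
      ≡⟨ ++-solve 4 (λ X F Y o → X ⊕ (o ⊕ (F ⊕ (Y ⊕ o))) ⊜ (X ⊕ (o ⊕ (F ⊕ Y))) ⊕ o) refl (𝟎^ κ x) (Φ t) (𝟎^ κ y) (𝟏 ∷ []) ⟩
    (𝟎^ κ x ++ 𝟏 ∷ Φ t ++ 𝟎^ κ y) ∷ʳ 𝟏 ∎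

  Φ-≡[] : ∀ s → Φ s ≡ [] → s ≡ []
  Φ-≡[] []      _    = refl
  Φ-≡[] (c ∷ s) Φs≡[] with () ← ++-conicalʳ (𝟎^ κ c) _ (trans (sym (Φ-∷ c s)) Φs≡[])

  length-≤-Φ : ∀ t → length t ≤ length (Φ t)
  length-≤-Φ []      = z≤n
  length-≤-Φ (c ∷ t) rewrite Φ-∷ c t | length-++ (𝟎^ κ c) {𝟏 ∷ Φ t} =
    ≤-trans (s≤s (length-≤-Φ t)) (m≤n+m _ (length (𝟎^ κ c)))

  reverse-Φ : ∀ t → reverse (Φ t) ∷ʳ 𝟏 ≡ 𝟏 ∷ Φ (reverse t)
  reverse-Φ []      = refl
  reverse-Φ (c ∷ t) = begin
    reverse (Φ (c ∷ t)) ∷ʳ 𝟏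
      ≡⟨ cong (λ u → reverse u ∷ʳ 𝟏) (Φ-∷ c t) ⟩
    reverse (𝟎^ κ c ++ 𝟏 ∷ Φ t) ∷ʳ 𝟏
      ≡⟨ cong (_∷ʳ 𝟏) (reverse-++ (𝟎^ κ c) (𝟏 ∷ Φ t)) ⟩
    (reverse (𝟏 ∷ Φ t) ++ reverse (𝟎^ κ c)) ∷ʳ 𝟏
      ≡⟨ cong₂ (λ u v → (u ++ v) ∷ʳ 𝟏) (unfold-reverse 𝟏 (Φ t)) (reverse-𝟎^ (κ c)) ⟩
    ((reverse (Φ t) ∷ʳ 𝟏) ++ 𝟎^ κ c) ∷ʳ 𝟏
      ≡⟨ ++-assoc (reverse (Φ t) ∷ʳ 𝟏) (𝟎^ κ c) (𝟏 ∷ []) ⟩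
    (reverse (Φ t) ∷ʳ 𝟏) ++ 𝟎^ κ c ++ 𝟏 ∷ []
      ≡⟨ cong₂ _++_ (reverse-Φ t) (sym Φ-[ c ]) ⟩
    𝟏 ∷ Φ (reverse t) ++ Φ (c ∷ [])
      ≡⟨ cong (𝟏 ∷_) (Φ-++ (reverse t) (c ∷ [])) ⟨
    𝟏 ∷ Φ (reverse t ∷ʳ c)
      ≡⟨ cong (λ u → 𝟏 ∷ Φ u) (unfold-reverse c t) ⟨
    𝟏 ∷ Φ (reverse (c ∷ t)) ∎

  Φ-≢-∷ʳ-𝟎 : ∀ s x → Φ s ≢ x ∷ʳ 𝟎
  Φ-≢-∷ʳ-𝟎 s x Φs≡x𝟎 = 𝟎≢𝟏 (∷-injectiveˡ (begin
    𝟎 ∷ (reverse x ∷ʳ 𝟏)      ≡⟨ cong (_∷ʳ 𝟏) (reverse-++ x (𝟎 ∷ [])) ⟨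
    reverse (x ∷ʳ 𝟎) ∷ʳ 𝟏     ≡⟨ cong (λ u → reverse u ∷ʳ 𝟏) Φs≡x𝟎 ⟨
    reverse (Φ s) ∷ʳ 𝟏        ≡⟨ reverse-Φ s ⟩
    𝟏 ∷ Φ (reverse s)         ∎))

  Φ-mono-⊑ : ∀ {u v} → u ⊑ v → Φ u ⊑ Φ v
  Φ-mono-⊑ {u} (x , y , refl) = Φ x , Φ y , (begin
    Φ x ++ Φ u ++ Φ y  ≡⟨ cong (Φ x ++_) (Φ-++ u y) ⟨
    Φ x ++ Φ (u ++ y)  ≡⟨ Φ-++ x (u ++ y) ⟨
    Φ (x ++ u ++ y)    ∎)

  Φ-∷-++ : ∀ c s y → Φ (c ∷ s) ++ y ≡ 𝟎^ κ c ++ 𝟏 ∷ Φ s ++ y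
  Φ-∷-++ c s y = trans (cong (_++ y) (Φ-∷ c s)) (++-assoc (𝟎^ κ c) (𝟏 ∷ Φ s) y)

  Φ-split-at-𝟏 : ∀ s x r → x ++ 𝟏 ∷ r ≡ Φ s →
    ∃ λ s₁ → ∃₂ λ c s₂ → s ≡ s₁ ++ c ∷ s₂ × x ≡ Φ s₁ ++ 𝟎^ κ c × r ≡ Φ s₂
  Φ-split-at-𝟏 []      x r e with () ← ++-conicalʳ x _ e
  Φ-split-at-𝟏 (c ∷ s) x r e with ++-split-𝟎^𝟏 (κ c) x (trans e (Φ-∷ c s))
  ... | inj₁ (i , zero , refl , r≡ , i+0≡κc) =
    [] , c , s , refl , cong 𝟎^_ (trans (sym (+-identityʳ i)) i+0≡κc) , ∷-injectiveʳ r≡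
  ... | inj₂ (x′ , refl , x′𝟏r≡Φs) with Φ-split-at-𝟏 s x′ r x′𝟏r≡Φs
  ...   | s₁ , c′ , s₂ , refl , refl , r≡ = c ∷ s₁ , c′ , s₂ , refl , sym (Φ-∷-++ c s₁ (𝟎^ κ c′)) , r≡

  prefix-of-Φ : ∀ s r y → r ++ y ≡ Φ s → ∃₂ λ t j → r ≡ Φ t ++ 𝟎^ j
  prefix-of-Φ []      []      y _ = [] , 0 , refl
  prefix-of-Φ (c ∷ s) r       y e with ++-split-𝟎^𝟏 (κ c) r (trans e (Φ-∷ c s))
  ... | inj₁ (j , _ , r≡𝟎^j , _) = [] , j , r≡𝟎^j
  ... | inj₂ (r′ , refl , r′y≡Φs) with prefix-of-Φ s r′ y r′y≡Φs
  ...   | t , j , refl = c ∷ t , j , sym (Φ-∷-++ c t (𝟎^ j))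

  Φ-prefix-of-Φ : ∀ t s y → Φ t ++ y ≡ Φ s → ∃ λ s₃ → s ≡ t ++ s₃ × y ≡ Φ s₃
  Φ-prefix-of-Φ []      s       y e = s , refl , e
  Φ-prefix-of-Φ (c ∷ t) []      y e with () ← ++-conicalʳ (𝟎^ κ c) _ (trans (sym (Φ-∷-++ c t y)) e)
  Φ-prefix-of-Φ (c ∷ t) (d ∷ s) y e
    with κc≡κd , Φty≡Φs ← 𝟎^𝟏-injective (κ c) (κ d) (trans (sym (Φ-∷-++ c t y)) (trans e (Φ-∷ d s)))
    with refl ← κ-injective c d κc≡κd
    with s₃ , refl , y≡ ← Φ-prefix-of-Φ t s y Φty≡Φs
    = s₃ , refl , y≡

  Φ-desubstitute : ∀ s x t y → x ++ 𝟏 ∷ Φ t ++ y ≡ Φ s →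
    ∃ λ s₁ → ∃₂ λ c s₃ → s ≡ s₁ ++ c ∷ t ++ s₃ × x ≡ Φ s₁ ++ 𝟎^ κ c × y ≡ Φ s₃
  Φ-desubstitute s x t y e
    with s₁ , c , s₂ , refl , x≡ , Φty≡Φs₂ ← Φ-split-at-𝟏 s x (Φ t ++ y) e
    with s₃ , refl , y≡ ← Φ-prefix-of-Φ t s₂ y Φty≡Φs₂
    = s₁ , c , s₃ , refl , x≡ , y≡

  Φ-no-𝟎^1+a : ∀ s x y → x ++ 𝟎^ suc a ++ y ≢ Φ s
  Φ-no-𝟎^1+a []      x y e with () ← ++-conicalʳ x _ e
  Φ-no-𝟎^1+a (c ∷ s) x y e with ++-split-𝟎^𝟏 (κ c) x (trans e (Φ-∷ c s))
  ... | inj₁ (i , j , _ , run≡ , i+j≡κc) =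
    n≮n a (≤-trans (𝟎^-prefix-≤ (suc a) j run≡) (≤-trans (m≤n+m j i) (≤-trans (≤-reflexive i+j≡κc) (κ≤a c))))
  ... | inj₂ (x′ , _ , x′run≡Φs) = Φ-no-𝟎^1+a s x′ y x′run≡Φs

  Φ-run : ∀ s x j y → x ++ 𝟏 ∷ 𝟎^ j ++ 𝟏 ∷ y ≡ Φ s → ∃ λ d → j ≡ κ d
  Φ-run s x j y e with Φ-split-at-𝟏 s x _ e
  ... | _ , _ , []     , _ , _ , r≡ with () ← ++-conicalʳ (𝟎^ j) _ r≡
  ... | _ , _ , d ∷ s₂ , _ , _ , r≡ = d , proj₁ (𝟎^𝟏-injective j (κ d) (trans r≡ (Φ-∷ d s₂)))

  Φ-trailing-𝟎^ : ∀ s m x n → Φ s ++ 𝟎^ m ≡ x ++ 𝟎^ n → n ≤ m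
  Φ-trailing-𝟎^ s m x n e with ≤-total n m
  ... | inj₁ n≤m = n≤m
  ... | inj₂ m≤n with m≤n⇒∃[o]m+o≡n m≤n
  ...   | zero  , refl = ≤-reflexive (+-identityʳ m)
  ...   | suc o , refl = ⊥-elim (Φ-≢-∷ʳ-𝟎 s (x ++ 𝟎^ o) (++-cancelʳ (𝟎^ m) _ _ (begin
    Φ s ++ 𝟎^ m
      ≡⟨ e ⟩
    x ++ 𝟎^ (m + suc o)
      ≡⟨ cong (λ n → x ++ 𝟎^ n) (+-comm m (suc o)) ⟩
    x ++ 𝟎 ∷ 𝟎^ (o + m)
      ≡⟨ cong (λ u → x ++ 𝟎 ∷ u) (𝟎^-+ o m) ⟩
    x ++ 𝟎 ∷ 𝟎^ o ++ 𝟎^ m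
      ≡⟨ cong (λ u → x ++ u ++ 𝟎^ m) (𝟎^-∷ʳ o) ⟨
    x ++ (𝟎^ o ∷ʳ 𝟎) ++ 𝟎^ m
      ≡⟨ ++-solve 4 (λ x z o m → x ⊕ ((z ⊕ o) ⊕ m) ⊜ ((x ⊕ z) ⊕ o) ⊕ m) refl x (𝟎^ o) (𝟎 ∷ []) (𝟎^ m) ⟩
    ((x ++ 𝟎^ o) ∷ʳ 𝟎) ++ 𝟎^ m ∎)))

  Φ-injective : ∀ s t → Φ s ≡ Φ t → s ≡ t
  Φ-injective s t Φs≡Φt with s₃ , refl , []≡Φs₃ ← Φ-prefix-of-Φ s t [] (trans (++-identityʳ (Φ s)) Φs≡Φt)
    with refl ← Φ-≡[] s₃ (sym []≡Φs₃) = sym (++-identityʳ s)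

  -- frame b is definitionally T a b.
  frame : ℕ → Word → Word
  frame i t = 𝟎^ i ++ 𝟏 ∷ Φ t ++ 𝟎^ i

  reverse-frame : ∀ i t j → reverse (𝟎^ i ++ 𝟏 ∷ Φ t ++ 𝟎^ j) ≡ 𝟎^ j ++ 𝟏 ∷ Φ (reverse t) ++ 𝟎^ i
  reverse-frame i t j = begin
    reverse (𝟎^ i ++ 𝟏 ∷ Φ t ++ 𝟎^ j)
      ≡⟨ reverse-++ (𝟎^ i) (𝟏 ∷ Φ t ++ 𝟎^ j) ⟩
    reverse (𝟏 ∷ Φ t ++ 𝟎^ j) ++ reverse (𝟎^ i)
      ≡⟨ cong₂ _++_ (unfold-reverse 𝟏 (Φ t ++ 𝟎^ j)) (reverse-𝟎^ i) ⟩
    (reverse (Φ t ++ 𝟎^ j) ∷ʳ 𝟏) ++ 𝟎^ i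
      ≡⟨ cong (λ u → (u ∷ʳ 𝟏) ++ 𝟎^ i) (reverse-++ (Φ t) (𝟎^ j)) ⟩
    ((reverse (𝟎^ j) ++ reverse (Φ t)) ∷ʳ 𝟏) ++ 𝟎^ i
      ≡⟨ cong (λ u → ((u ++ reverse (Φ t)) ∷ʳ 𝟏) ++ 𝟎^ i) (reverse-𝟎^ j) ⟩
    ((𝟎^ j ++ reverse (Φ t)) ∷ʳ 𝟏) ++ 𝟎^ i
      ≡⟨ ++-solve 4 (λ z r o z′ → ((z ⊕ r) ⊕ o) ⊕ z′ ⊜ z ⊕ ((r ⊕ o) ⊕ z′)) refl (𝟎^ j) (reverse (Φ t)) (𝟏 ∷ []) (𝟎^ i) ⟩
    𝟎^ j ++ (reverse (Φ t) ∷ʳ 𝟏) ++ 𝟎^ i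
      ≡⟨ cong (λ u → 𝟎^ j ++ u ++ 𝟎^ i) (reverse-Φ t) ⟩
    𝟎^ j ++ 𝟏 ∷ Φ (reverse t) ++ 𝟎^ i ∎

  wrap-𝟏-frame : ∀ z t → wrap 𝟏 (frame (κ z) t) ≡ 𝟏 ∷ Φ (wrap z t)
  wrap-𝟏-frame z t = cong (𝟏 ∷_) (sym (Φ-wrap z t z))

  𝟎^b𝟏Φ-suffix : ∀ w → ∃ λ w′ → 𝟎^ b ++ 𝟏 ∷ Φ w ≡ w′ ++ 𝟎^ b ++ 𝟏 ∷ []
  𝟎^b𝟏Φ-suffix []      = [] , refl
  𝟎^b𝟏Φ-suffix (z ∷ w) with w′ , e ← 𝟎^b𝟏Φ-suffix w | d , d+b≡κz ← m≤n⇒∃[o]m+o≡n (b≤κ z) =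
    𝟎^ b ++ 𝟏 ∷ 𝟎^ d ++ w′ , (begin
      𝟎^ b ++ 𝟏 ∷ Φ (z ∷ w)
        ≡⟨ cong (λ u → 𝟎^ b ++ 𝟏 ∷ u) (Φ-∷ z w) ⟩
      𝟎^ b ++ 𝟏 ∷ 𝟎^ κ z ++ 𝟏 ∷ Φ w
        ≡⟨ cong (λ n → 𝟎^ b ++ 𝟏 ∷ 𝟎^ n ++ 𝟏 ∷ Φ w) (trans (sym d+b≡κz) (+-comm b d)) ⟩
      𝟎^ b ++ 𝟏 ∷ 𝟎^ (d + b) ++ 𝟏 ∷ Φ w
        ≡⟨ cong (λ u → 𝟎^ b ++ 𝟏 ∷ u ++ 𝟏 ∷ Φ w) (𝟎^-+ d b) ⟩
      𝟎^ b ++ 𝟏 ∷ (𝟎^ d ++ 𝟎^ b) ++ 𝟏 ∷ Φ w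
        ≡⟨ ++-solve 4 (λ B o D F → B ⊕ (o ⊕ ((D ⊕ B) ⊕ (o ⊕ F))) ⊜ B ⊕ (o ⊕ (D ⊕ (B ⊕ (o ⊕ F)))))
            refl (𝟎^ b) (𝟏 ∷ []) (𝟎^ d) (Φ w) ⟩
      𝟎^ b ++ 𝟏 ∷ 𝟎^ d ++ 𝟎^ b ++ 𝟏 ∷ Φ w
        ≡⟨ cong (λ u → 𝟎^ b ++ 𝟏 ∷ 𝟎^ d ++ u) e ⟩
      𝟎^ b ++ 𝟏 ∷ 𝟎^ d ++ w′ ++ 𝟎^ b ++ 𝟏 ∷ []
        ≡⟨ ++-solve 5 (λ B o D W rest → B ⊕ (o ⊕ (D ⊕ (W ⊕ rest))) ⊜ (B ⊕ (o ⊕ (D ⊕ W))) ⊕ rest)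
            refl (𝟎^ b) (𝟏 ∷ []) (𝟎^ d) w′ (𝟎^ b ++ 𝟏 ∷ []) ⟩
      (𝟎^ b ++ 𝟏 ∷ 𝟎^ d ++ w′) ++ 𝟎^ b ++ 𝟏 ∷ [] ∎)

  Φ-reverse-𝟎^b : ∀ w w′ → 𝟎^ b ++ 𝟏 ∷ Φ w ≡ w′ ++ 𝟎^ b ++ 𝟏 ∷ [] → Φ (reverse w) ++ 𝟎^ b ≡ 𝟎^ b ++ reverse w′
  Φ-reverse-𝟎^b w w′ e = ∷-injectiveʳ (begin
    𝟏 ∷ Φ (reverse w) ++ 𝟎^ b
      ≡⟨ reverse-frame b w 0 ⟨
    reverse (𝟎^ b ++ 𝟏 ∷ Φ w ++ [])
      ≡⟨ cong (λ u → reverse (𝟎^ b ++ 𝟏 ∷ u)) (++-identityʳ (Φ w)) ⟩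
    reverse (𝟎^ b ++ 𝟏 ∷ Φ w)
      ≡⟨ cong reverse e ⟩
    reverse (w′ ++ 𝟎^ b ++ 𝟏 ∷ [])
      ≡⟨ reverse-++ w′ (𝟎^ b ++ 𝟏 ∷ []) ⟩
    reverse (𝟎^ b ++ 𝟏 ∷ []) ++ reverse w′
      ≡⟨ cong (_++ reverse w′) (trans (reverse-++ (𝟎^ b) (𝟏 ∷ [])) (cong (𝟏 ∷_) (reverse-𝟎^ b))) ⟩
    𝟏 ∷ 𝟎^ b ++ reverse w′ ∎)

  T-centre : ∀ {p q} → HasCenter p q → HasCenter (T a b p) (T a b q)
  T-centre {q = q} (w , refl) with w′ , e ← 𝟎^b𝟏Φ-suffix w = w′ , (begin
    𝟎^ b ++ 𝟏 ∷ Φ (w ++ q ++ reverse w) ++ 𝟎^ b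
      ≡⟨ cong (λ u → 𝟎^ b ++ 𝟏 ∷ u ++ 𝟎^ b) Φ-w-q-w̄ ⟩
    𝟎^ b ++ 𝟏 ∷ (Φ w ++ Φ q ++ Φ (reverse w)) ++ 𝟎^ b
      ≡⟨ ++-solve 6 (λ B o W Q W̄ B′ → B ⊕ (o ⊕ ((W ⊕ (Q ⊕ W̄)) ⊕ B′)) ⊜ (B ⊕ (o ⊕ W)) ⊕ (Q ⊕ (W̄ ⊕ B′)))
          refl (𝟎^ b) (𝟏 ∷ []) (Φ w) (Φ q) (Φ (reverse w)) (𝟎^ b) ⟩
    (𝟎^ b ++ 𝟏 ∷ Φ w) ++ Φ q ++ Φ (reverse w) ++ 𝟎^ b
      ≡⟨ cong₂ (λ u v → u ++ Φ q ++ v) e (Φ-reverse-𝟎^b w w′ e) ⟩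
    (w′ ++ 𝟎^ b ++ 𝟏 ∷ []) ++ Φ q ++ 𝟎^ b ++ reverse w′
      ≡⟨ ++-solve 6 (λ W B o Q B′ W̄ → (W ⊕ (B ⊕ o)) ⊕ (Q ⊕ (B′ ⊕ W̄)) ⊜ W ⊕ ((B ⊕ (o ⊕ (Q ⊕ B′))) ⊕ W̄))
          refl w′ (𝟎^ b) (𝟏 ∷ []) (Φ q) (𝟎^ b) (reverse w′) ⟩
    w′ ++ (𝟎^ b ++ 𝟏 ∷ Φ q ++ 𝟎^ b) ++ reverse w′ ∎)
    where
    Φ-w-q-w̄ : Φ (w ++ q ++ reverse w) ≡ Φ w ++ Φ q ++ Φ (reverse w)
    Φ-w-q-w̄ = trans (Φ-++ w (q ++ reverse w)) (cong (Φ w ++_) (Φ-++ q (reverse w)))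

  T-step-ε : ∀ {p} → HasCenter p ε → HasCenter (T a b p) (𝟏 ∷ [])
  T-step-ε h = HasCenter-trans (T-centre h) (𝟎^-pad-centre b (𝟏 ∷ []))

  T-[z]-centre : ∀ z → HasCenter (T a b (z ∷ [])) (𝟎^ κ z)
  T-[z]-centre z = HasCenter-trans (𝟎^-pad-centre b (𝟏 ∷ Φ (z ∷ []))) ((𝟏 ∷ []) , cong (𝟏 ∷_) Φ-[ z ])

  T-step-letter : ∀ {p z c} → HasCenter p (z ∷ []) → HasCenter (𝟎^ κ z) c → HasCenter (T a b p) c
  T-step-letter {z = z} h hz = HasCenter-trans (T-centre h) (HasCenter-trans (T-[z]-centre z) hz)

module Fixpoint (a b : ℕ) (1≤b : 1 ≤ b) (b<a∸1 : b < a ∸ 1) where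

  b<a : b < a
  b<a = <-≤-trans b<a∸1 (m∸n≤m a 1)

  open Morphism a b b<a

  2≤a : 2 ≤ a
  2≤a = ≤-trans (s≤s 1≤b) b<a

  1≤a : 1 ≤ a
  1≤a = ≤-trans (s≤s z≤n) 2≤a

  1+[a∸1]≡a : suc (a ∸ 1) ≡ a
  1+[a∸1]≡a = trans (+-comm 1 (a ∸ 1)) (m∸n+n≡m 1≤a)

  φ^𝟎 : ℕ → Word
  φ^𝟎 m = φ^ a b m (𝟎 ∷ [])

  φ^-suc : ∀ m w → φ^ a b (suc m) w ≡ φ^ a b m (Φ w)
  φ^-suc zero    w = refl
  φ^-suc (suc m) w = cong Φ (φ^-suc m w)

  φ^-++ : ∀ m x y → φ^ a b m (x ++ y) ≡ φ^ a b m x ++ φ^ a b m y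
  φ^-++ zero    x y = refl
  φ^-++ (suc m) x y = trans (cong Φ (φ^-++ m x y)) (Φ-++ (φ^ a b m x) (φ^ a b m y))

  φ^𝟎-head : ∀ m → ∃ λ r → φ^𝟎 m ≡ 𝟎 ∷ r
  φ^𝟎-head zero    = [] , refl
  φ^𝟎-head (suc m) with r , e ← φ^𝟎-head m = 𝟎^ (a ∸ 1) ++ 𝟏 ∷ Φ r , (begin
    Φ (φ^𝟎 m)                   ≡⟨ cong Φ e ⟩
    Φ (𝟎 ∷ r)                   ≡⟨ Φ-∷ 𝟎 r ⟩
    𝟎^ a ++ 𝟏 ∷ Φ r             ≡⟨ cong (λ n → 𝟎^ n ++ 𝟏 ∷ Φ r) 1+[a∸1]≡a ⟨
    𝟎 ∷ 𝟎^ (a ∸ 1) ++ 𝟏 ∷ Φ r   ∎)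

  φ^𝟎-square-prefix : ∀ m → ∃ λ r → φ^𝟎 (suc m) ≡ φ^𝟎 m ++ φ^𝟎 m ++ r
  φ^𝟎-square-prefix m with a₂ , 2+a₂≡a ← m≤n⇒∃[o]m+o≡n 2≤a = φ^ a b m (𝟎^ a₂ ++ 𝟏 ∷ []) , (begin
    φ^𝟎 (suc m)
      ≡⟨ φ^-suc m (𝟎 ∷ []) ⟩
    φ^ a b m (Φ (𝟎 ∷ []))
      ≡⟨ cong (φ^ a b m) (trans Φ-[ 𝟎 ] (cong (λ n → 𝟎^ n ++ 𝟏 ∷ []) (sym 2+a₂≡a))) ⟩
    φ^ a b m ((𝟎 ∷ []) ++ (𝟎 ∷ []) ++ 𝟎^ a₂ ++ 𝟏 ∷ [])
      ≡⟨ φ^-++ m (𝟎 ∷ []) _ ⟩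
    φ^𝟎 m ++ φ^ a b m ((𝟎 ∷ []) ++ 𝟎^ a₂ ++ 𝟏 ∷ [])
      ≡⟨ cong (φ^𝟎 m ++_) (φ^-++ m (𝟎 ∷ []) _) ⟩
    φ^𝟎 m ++ φ^𝟎 m ++ φ^ a b m (𝟎^ a₂ ++ 𝟏 ∷ []) ∎)

  φ^𝟎-extends : ∀ m → ∃₂ λ z r → φ^𝟎 (suc m) ≡ φ^𝟎 m ++ z ∷ r
  φ^𝟎-extends m with r , sq ← φ^𝟎-square-prefix m | r₀ , hd ← φ^𝟎-head m =
    𝟎 , r₀ ++ r , trans sq (cong (λ u → φ^𝟎 m ++ u ++ r) hd)

  -- Factors of u_β, read inside its prefixes φ^m(0); Occurs⇒Factor and Factor⇒Occurs
  -- identify this with Factor a b.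
  Occurs : Word → Set
  Occurs w = ∃ λ m → w ⊑ φ^𝟎 m

  Occurs-⊑ : ∀ {u v} → u ⊑ v → Occurs v → Occurs u
  Occurs-⊑ u⊑v (m , v⊑) = m , ⊑-trans u⊑v v⊑

  Occurs-Φ : ∀ {w} → Occurs w → Occurs (Φ w)
  Occurs-Φ (m , w⊑) = suc m , Φ-mono-⊑ w⊑

  Occurs-desubstitute : ∀ {x r} → Occurs (x ++ 𝟏 ∷ r) → ∃ λ s → Occurs s × x ++ 𝟏 ∷ r ⊑ Φ s
  Occurs-desubstitute {x} {r} (zero  , w⊑) = contradiction w⊑ (𝟏-⋢-[𝟎] x r)
  Occurs-desubstitute         (suc m , w⊑) = φ^𝟎 m , (m , ⊑-refl _) , w⊑

  Occurs-extendʳ : ∀ {w} → Occurs w → ∃ λ y → Occurs (w ∷ʳ y)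
  Occurs-extendʳ {w} (m , X , y ∷ Y , e) = y , m , X , Y , trans (cong (X ++_) (++-assoc w (y ∷ []) Y)) e
  Occurs-extendʳ {w} (m , X , [] , e) with z , r , ext ← φ^𝟎-extends m = z , suc m , X , r , (begin
    X ++ (w ∷ʳ z) ++ r    ≡⟨ ++-solve 4 (λ X w z r → X ⊕ ((w ⊕ z) ⊕ r) ⊜ (X ⊕ w) ⊕ (z ⊕ r)) refl X w (z ∷ []) r ⟩
    (X ++ w) ++ z ∷ r     ≡⟨ cong (λ u → (X ++ u) ++ z ∷ r) (++-identityʳ w) ⟨
    (X ++ w ++ []) ++ z ∷ r ≡⟨ cong (_++ z ∷ r) e ⟩
    φ^𝟎 m ++ z ∷ r        ≡⟨ ext ⟨
    φ^𝟎 (suc m)           ∎)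

  -- φ^(m+1)(0) begins with two copies of φ^m(0) since a ≥ 2, and inside the second copy
  -- every factor has a left neighbour.
  Occurs-extendˡ : ∀ {w} → Occurs w → ∃ λ x → Occurs (x ∷ w)
  Occurs-extendˡ {w} (m , X , Y , e)
    with r , sq ← φ^𝟎-square-prefix m | r₀ , hd ← φ^𝟎-head m
    with P , x , P∷ʳx≡ ← ∷-as-∷ʳ 𝟎 (r₀ ++ X)
    = x , suc m , P , Y ++ r , (begin
      P ++ (x ∷ w) ++ Y ++ r
        ≡⟨ ++-solve 5 (λ P x w Y r → P ⊕ ((x ⊕ w) ⊕ (Y ⊕ r)) ⊜ (P ⊕ x) ⊕ (w ⊕ (Y ⊕ r))) refl P (x ∷ []) w Y r ⟩
      (P ∷ʳ x) ++ w ++ Y ++ r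
        ≡⟨ cong (_++ w ++ Y ++ r) P∷ʳx≡ ⟨
      (𝟎 ∷ r₀ ++ X) ++ w ++ Y ++ r
        ≡⟨ cong (λ u → (u ++ X) ++ w ++ Y ++ r) hd ⟨
      (φ^𝟎 m ++ X) ++ w ++ Y ++ r
        ≡⟨ ++-solve 5 (λ F X w Y r → (F ⊕ X) ⊕ (w ⊕ (Y ⊕ r)) ⊜ F ⊕ ((X ⊕ (w ⊕ Y)) ⊕ r)) refl (φ^𝟎 m) X w Y r ⟩
      φ^𝟎 m ++ (X ++ w ++ Y) ++ r
        ≡⟨ cong (λ u → φ^𝟎 m ++ u ++ r) e ⟩
      φ^𝟎 m ++ φ^𝟎 m ++ r
        ≡⟨ sq ⟨
      φ^𝟎 (suc m) ∎)

  Occurs-extend : ∀ {w} → Occurs w → ∃₂ λ x y → Occurs (x ∷ w ++ y ∷ [])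
  Occurs-extend occ with y , occʳ ← Occurs-extendʳ occ with x , occˡʳ ← Occurs-extendˡ occʳ = x , y , occˡʳ

  Occurs-𝟎^ : ∀ {n} → n ≤ a → Occurs (𝟎^ n)
  Occurs-𝟎^ n≤a = 1 , ⊑-trans (𝟎^-mono-⊑ n≤a) ([] , 𝟏 ∷ [] , sym Φ-[ 𝟎 ])

  ¬Occurs-𝟎^1+a : ¬ Occurs (𝟎^ suc a)
  ¬Occurs-𝟎^1+a (zero  , ⊑[𝟎])    = n≮n 1 (≤-trans (s≤s 1≤a) (subst (_≤ 1) (length-replicate (suc a)) (⊑-length ⊑[𝟎])))
  ¬Occurs-𝟎^1+a (suc m , X , Y , e) = Φ-no-𝟎^1+a (φ^𝟎 m) X Y e

  Occurs-𝟏𝟎^𝟏⇒κ : ∀ {j} → Occurs (𝟏 ∷ 𝟎^ j ++ 𝟏 ∷ []) → ∃ λ d → j ≡ κ d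
  Occurs-𝟏𝟎^𝟏⇒κ {j} occ with s , _ , X , Y , e ← Occurs-desubstitute {[]} occ =
    Φ-run s X j Y (trans (cong (λ u → X ++ 𝟏 ∷ u) (sym (++-assoc (𝟎^ j) (𝟏 ∷ []) Y))) e)

  Occurs-𝟏∷Φ⁻ : ∀ {t} → Occurs (𝟏 ∷ Φ t) → Occurs t
  Occurs-𝟏∷Φ⁻ {t} occ
    with s , occ-s , X , Y , e ← Occurs-desubstitute {[]} occ
    with s₁ , c , s₃ , refl , _ , _ ← Φ-desubstitute s X t Y e
    = Occurs-⊑ (s₁ ++ c ∷ [] , s₃ , ++-assoc s₁ (c ∷ []) (t ++ s₃)) occ-s

  Occurs-𝟏∷Φ⁺ : ∀ {t} → Occurs t → Occurs (𝟏 ∷ Φ t)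
  Occurs-𝟏∷Φ⁺ {t} occ with x , occ-xt ← Occurs-extendˡ occ =
    Occurs-⊑ (subst (𝟏 ∷ Φ t ⊑_) (sym (Φ-∷ x t)) (⊑-suffix (𝟎^ κ x) (𝟏 ∷ Φ t))) (Occurs-Φ occ-xt)

  frame-⊑-Φ-wrap : ∀ {n} x t y → n ≤ κ x → n ≤ κ y → frame n t ⊑ Φ (x ∷ t ++ y ∷ [])
  frame-⊑-Φ-wrap x t y n≤κx n≤κy =
    ⊑-trans (𝟎^-pad-⊑ (𝟏 ∷ Φ t) n≤κx n≤κy) (subst (𝟎^ κ x ++ 𝟏 ∷ Φ t ++ 𝟎^ κ y ⊑_) (sym (Φ-wrap x t y)) (⊑-prefix _ (𝟏 ∷ [])))

  Occurs-frame-≤b : ∀ {n t} → n ≤ b → Occurs t → Occurs (frame n t)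
  Occurs-frame-≤b {t = t} n≤b occ with x , y , occ-xty ← Occurs-extend occ =
    Occurs-⊑ (frame-⊑-Φ-wrap x t y (≤-trans n≤b (b≤κ x)) (≤-trans n≤b (b≤κ y))) (Occurs-Φ occ-xty)

  Occurs-frame⁺ : ∀ {n t} → n ≤ a → Occurs (wrap 𝟎 t) → Occurs (frame n t)
  Occurs-frame⁺ {t = t} n≤a occ = Occurs-⊑ (frame-⊑-Φ-wrap 𝟎 t 𝟎 n≤a n≤a) (Occurs-Φ occ)

  Occurs-frame⁻ : ∀ {t} → Occurs (frame (suc b) t) → Occurs (wrap 𝟎 t)
  Occurs-frame⁻ {t} occ with s , occ-s , X , Y , e ← Occurs-desubstitute {𝟎^ suc b} occ
    with Φ-desubstitute s (X ++ 𝟎^ suc b) t (𝟎^ suc b ++ Y)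
           (trans (++-solve 5 (λ X B o F Y → (X ⊕ B) ⊕ (o ⊕ (F ⊕ (B ⊕ Y))) ⊜ X ⊕ ((B ⊕ (o ⊕ (F ⊕ B))) ⊕ Y))
               refl X (𝟎^ suc b) (𝟏 ∷ []) (Φ t) Y) e)
  ... | s₁ , c , d ∷ s₃ , refl , X𝟎^≡ , 𝟎^Y≡
    with refl ← b<κ⇒𝟎 c (Φ-trailing-𝟎^ s₁ (κ c) X (suc b) (sym X𝟎^≡))
    with refl ← b<κ⇒𝟎 d (𝟎^-prefix-≤ (suc b) (κ d) (trans 𝟎^Y≡ (Φ-∷ d s₃)))
    = Occurs-⊑ (s₁ , s₃ , cong (λ u → s₁ ++ 𝟎 ∷ u) (++-assoc t (𝟎 ∷ []) s₃)) occ-s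

  Occurs-wrap-T : ∀ z t → Occurs (wrap z (T a b t)) ⇔ Occurs (wrap z t)
  Occurs-wrap-T 𝟎 t = mk⇔
    (λ occ → Occurs-frame⁻ (subst Occurs (wrap-𝟎^ b (𝟏 ∷ Φ t)) occ))
    (λ occ → subst Occurs (sym (wrap-𝟎^ b (𝟏 ∷ Φ t))) (Occurs-frame⁺ b<a occ))
  Occurs-wrap-T 𝟏 t = mk⇔
    (λ occ → Occurs-𝟏∷Φ⁻ (subst Occurs (wrap-𝟏-frame 𝟏 t) occ))
    (λ occ → subst Occurs (sym (wrap-𝟏-frame 𝟏 t)) (Occurs-𝟏∷Φ⁺ occ))

  -- Maximal palindromes are the U⁽ⁿ⁾

  MaxPal : Word → Set
  MaxPal = MaximalPalindromeIn Occurs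

  T-maxPal⁺ : ∀ {t} → MaxPal t → MaxPal (T a b t)
  T-maxPal⁺ {t} (pal , occ , ¬occ𝟎 , ¬occ𝟏) =
      trans (reverse-frame b t b) (cong (frame b) pal)
    , Occurs-frame-≤b ≤-refl occ
    , (λ occ𝟎 → ¬occ𝟎 (Equivalence.to (Occurs-wrap-T 𝟎 t) occ𝟎))
    , (λ occ𝟏 → ¬occ𝟏 (Equivalence.to (Occurs-wrap-T 𝟏 t) occ𝟏))

  T-maxPal⁻ : ∀ {t} → Palindrome t → Occurs t → MaxPal (T a b t) → MaxPal t
  T-maxPal⁻ {t} pal occ (_ , _ , ¬occ𝟎 , ¬occ𝟏) =
      pal
    , occ
    , (λ occ𝟎 → ¬occ𝟎 (Equivalence.from (Occurs-wrap-T 𝟎 t) occ𝟎))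
    , (λ occ𝟏 → ¬occ𝟏 (Equivalence.from (Occurs-wrap-T 𝟏 t) occ𝟏))

  U₁-maxPal : MaxPal (U a b 1)
  U₁-maxPal = reverse-𝟎^ (a ∸ 1) , Occurs-𝟎^ (m∸n≤m a 1) , ¬occ𝟎 , ¬occ𝟏
    where
    ¬occ𝟎 : ¬ Occurs (wrap 𝟎 (𝟎^ (a ∸ 1)))
    ¬occ𝟎 occ = ¬Occurs-𝟎^1+a (subst Occurs (trans (cong (𝟎 ∷_) (𝟎^-∷ʳ (a ∸ 1))) (cong (λ n → 𝟎^ suc n) 1+[a∸1]≡a)) occ)
    ¬occ𝟏 : ¬ Occurs (wrap 𝟏 (𝟎^ (a ∸ 1)))
    ¬occ𝟏 occ with Occurs-𝟏𝟎^𝟏⇒κ occ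
    ... | 𝟎 , a∸1≡a = <⇒≢ (≤-reflexive 1+[a∸1]≡a) a∸1≡a
    ... | 𝟏 , a∸1≡b = >⇒≢ b<a∸1 a∸1≡b

  U-maxPal : ∀ n → MaxPal (U a b (suc n))
  U-maxPal zero    = U₁-maxPal
  U-maxPal (suc n) = T-maxPal⁺ (U-maxPal n)

  Occurs-wrap-𝟏-𝟎^a : Occurs (wrap 𝟏 (𝟎^ a))
  Occurs-wrap-𝟏-𝟎^a = subst (λ u → Occurs (𝟏 ∷ u)) Φ-[ 𝟎 ] (Occurs-𝟏∷Φ⁺ (0 , ⊑-refl (𝟎 ∷ [])))

  maxPal-𝟎^ : ∀ {i} → MaxPal (𝟎^ i) → i ≡ a ∸ 1
  maxPal-𝟎^ {i} (_ , occ , ¬occ𝟎 , ¬occ𝟏) with <-cmp i (a ∸ 1)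
  ... | tri≈ _ i≡a∸1 _ = i≡a∸1
  ... | tri< i<a∸1 _ _ =
    ⊥-elim (¬occ𝟎 (subst Occurs (sym (cong (𝟎 ∷_) (𝟎^-∷ʳ i))) (Occurs-𝟎^ (subst (2 + i ≤_) 1+[a∸1]≡a (s≤s i<a∸1)))))
  ... | tri> _ _ a∸1<i with m≤n⇒m<n∨m≡n (subst (_≤ i) 1+[a∸1]≡a a∸1<i)
  ...   | inj₁ a<i  = ⊥-elim (¬Occurs-𝟎^1+a (Occurs-⊑ (𝟎^-mono-⊑ a<i) occ))
  ...   | inj₂ refl = ⊥-elim (¬occ𝟏 Occurs-wrap-𝟏-𝟎^a)

  Occurs-after-𝟏 : ∀ {x r} → Occurs (x ++ 𝟏 ∷ r) → ∃₂ λ t j → r ≡ Φ t ++ 𝟎^ j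
  Occurs-after-𝟏 {x} {r} occ
    with s , _ , X , Y , e ← Occurs-desubstitute occ
    with _ , _ , s₂ , _ , _ , rY≡Φs₂ ← Φ-split-at-𝟏 s (X ++ x) (r ++ Y)
           (trans (++-around-𝟏 X x r Y) e)
    = prefix-of-Φ s₂ r Y rY≡Φs₂

  palindrome-𝟎^𝟏Φ𝟎^ : ∀ i t j → Palindrome (𝟎^ i ++ 𝟏 ∷ Φ t ++ 𝟎^ j) → j ≡ i × Palindrome t
  palindrome-𝟎^𝟏Φ𝟎^ i t j pal with refl , Φt̄𝟎^≡Φt𝟎^ ← 𝟎^𝟏-injective j i (trans (sym (reverse-frame i t j)) pal) =
    refl , Φ-injective (reverse t) t (++-cancelʳ (𝟎^ j) _ _ Φt̄𝟎^≡Φt𝟎^)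

  maxPal-𝟎^𝟏 : ∀ {i r} → MaxPal (𝟎^ i ++ 𝟏 ∷ r) → ∃ λ t → r ≡ Φ t ++ 𝟎^ i × Palindrome t
  maxPal-𝟎^𝟏 {i} (pal , occ , _)
    with t , j , refl ← Occurs-after-𝟏 occ
    with refl , pal-t ← palindrome-𝟎^𝟏Φ𝟎^ i t j pal
    = t , refl , pal-t

  ¬maxPal-frame-above-b : ∀ {i t} → b < i → ¬ MaxPal (frame i t)
  ¬maxPal-frame-above-b {i} {t} b<i (_ , occ , ¬occ𝟎 , ¬occ𝟏) = go (<-cmp i a)
    where
    occ-𝟎t𝟎 : Occurs (wrap 𝟎 t)
    occ-𝟎t𝟎 = Occurs-frame⁻ (Occurs-⊑ (𝟎^-pad-⊑ (𝟏 ∷ Φ t) b<i b<i) occ)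
    go : Tri (i < a) (i ≡ a) (a < i) → ⊥
    go (tri< i<a _ _)  = ¬occ𝟎 (subst Occurs (sym (wrap-𝟎^ i (𝟏 ∷ Φ t))) (Occurs-frame⁺ i<a occ-𝟎t𝟎))
    go (tri≈ _ refl _) = ¬occ𝟏 (subst Occurs (sym (wrap-𝟏-frame 𝟎 t)) (Occurs-𝟏∷Φ⁺ occ-𝟎t𝟎))
    go (tri> _ _ a<i)  = ¬Occurs-𝟎^1+a (Occurs-⊑ (⊑-trans (𝟎^-mono-⊑ a<i) (⊑-prefix (𝟎^ i) _)) occ)

  maxPal-frame-index : ∀ {i t} → Occurs t → MaxPal (frame i t) → i ≡ b
  maxPal-frame-index {i} {t} occ-t mp@(_ , _ , ¬occ𝟎 , _) with <-cmp i b
  ... | tri≈ _ i≡b _ = i≡b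
  ... | tri< i<b _ _ = contradiction (subst Occurs (sym (wrap-𝟎^ i (𝟏 ∷ Φ t))) (Occurs-frame-≤b i<b occ-t)) ¬occ𝟎
  ... | tri> _ _ b<i = contradiction mp (¬maxPal-frame-above-b {t = t} b<i)

  length-<-frame : ∀ i t → length t < length (frame i t)
  length-<-frame i t = ≤-trans (s≤s (length-≤-Φ t)) (⊑-length (⊑-infix (𝟎^ i) (𝟏 ∷ Φ t) (𝟎^ i)))

  maxPal⇒U : ∀ {p} → MaxPal p → ∃ λ n → p ≡ U a b (suc n)
  maxPal⇒U {p} = go p (<-wellFounded (length p))
    where
    go : ∀ p → Acc _<_ (length p) → MaxPal p → ∃ λ n → p ≡ U a b (suc n)
    go p _ mp with 𝟎^-view p
    go p _        mp | inj₁ (i , refl) = 0 , cong 𝟎^_ (maxPal-𝟎^ mp)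
    go p (acc rs) mp | inj₂ (i , r , refl)
      with t , refl , pal-t ← maxPal-𝟎^𝟏 mp
      with occ-t ← Occurs-𝟏∷Φ⁻ (Occurs-⊑ (⊑-infix (𝟎^ i) (𝟏 ∷ Φ t) (𝟎^ i)) (proj₁ (proj₂ mp)))
      with refl ← maxPal-frame-index occ-t mp
      with n , refl ← go t (rs (length-<-frame b t)) (T-maxPal⁻ pal-t occ-t mp)
      = suc n , refl

  φ^𝟎-prefix : ∀ m d → ∃ λ r → φ^𝟎 (m + d) ≡ φ^𝟎 m ++ r
  φ^𝟎-prefix m zero    = [] , trans (cong φ^𝟎 (+-identityʳ m)) (sym (++-identityʳ (φ^𝟎 m)))
  φ^𝟎-prefix m (suc d) with r , e ← φ^𝟎-prefix m d with z , r′ , e′ ← φ^𝟎-extends (m + d) = r ++ z ∷ r′ , (begin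
    φ^𝟎 (m + suc d)        ≡⟨ cong φ^𝟎 (+-suc m d) ⟩
    φ^𝟎 (suc (m + d))      ≡⟨ e′ ⟩
    φ^𝟎 (m + d) ++ z ∷ r′  ≡⟨ cong (_++ z ∷ r′) e ⟩
    (φ^𝟎 m ++ r) ++ z ∷ r′ ≡⟨ ++-assoc (φ^𝟎 m) r (z ∷ r′) ⟩
    φ^𝟎 m ++ r ++ z ∷ r′   ∎)

  length-φ^𝟎 : ∀ m → m < length (φ^𝟎 m)
  length-φ^𝟎 zero    = s≤s z≤n
  length-φ^𝟎 (suc m) with z , r , e ← φ^𝟎-extends m =
    subst (λ v → suc m < length v) (sym e)
      (subst (suc m <_) (sym (length-++ (φ^𝟎 m))) (≤-trans (s≤s (length-φ^𝟎 m)) (m<m+n _ (s≤s z≤n))))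

  at-φ^𝟎-stable : ∀ {m n j} → m ≤ n → j < length (φ^𝟎 m) → at (φ^𝟎 n) j ≡ at (φ^𝟎 m) j
  at-φ^𝟎-stable {m} {j = j} m≤n j< with d , refl ← m≤n⇒∃[o]m+o≡n m≤n with r , e ← φ^𝟎-prefix m d =
    trans (cong (λ v → at v j) e) (at-++ˡ (φ^𝟎 m) r j<)

  uβ-at : ∀ M {j} → j < length (φ^𝟎 M) → uβ a b j ≡ at (φ^𝟎 M) j
  uβ-at M {j} j< with ≤-total (suc j) M
  ... | inj₁ 1+j≤M = sym (at-φ^𝟎-stable 1+j≤M (<-trans (n<1+n j) (length-φ^𝟎 (suc j))))
  ... | inj₂ M≤1+j = at-φ^𝟎-stable M≤1+j j<

  Occurs⇒Factor : ∀ {w} → Occurs w → Factor a b w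
  Occurs⇒Factor {w} (m , X , Y , e) = length X , (begin
    w                                                   ≡⟨ applyUpTo-at w ⟨
    applyUpTo (at w) (length w)                         ≡⟨ applyUpTo-cong (length w) at-w≡uβ ⟩
    applyUpTo (λ j → uβ a b (length X + j)) (length w)  ≡⟨ map-upTo _ (length w) ⟨
    map (λ j → uβ a b (length X + j)) (upTo (length w)) ∎)
    where
    at-w≡uβ : ∀ {j} → j < length w → at w j ≡ uβ a b (length X + j)
    at-w≡uβ {j} j<|w| = begin
      at w j                          ≡⟨ at-++ˡ w Y j<|w| ⟨
      at (w ++ Y) j                   ≡⟨ at-++ʳ X (w ++ Y) j ⟨
      at (X ++ w ++ Y) (length X + j) ≡⟨ cong (λ v → at v (length X + j)) e ⟩
      at (φ^𝟎 m) (length X + j)       ≡⟨ uβ-at m in-range ⟨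
      uβ a b (length X + j)           ∎
      where
      in-range : length X + j < length (φ^𝟎 m)
      in-range = subst (λ v → length X + j < length v) e
        (subst (length X + j <_) (sym (length-++ X)) (+-monoʳ-< (length X) (<-≤-trans j<|w| (length-++-≤ˡ w))))

  Factor⇒Occurs : ∀ {w} → Factor a b w → Occurs w
  Factor⇒Occurs {w} (i , e) =
    M , subst (_⊑ φ^𝟎 M) (sym w≡) (applyUpTo-at-⊑ (φ^𝟎 M) i (length w) (<⇒≤ (length-φ^𝟎 M)))
    where
    M = i + length w
    w≡ : w ≡ applyUpTo (λ j → at (φ^𝟎 M) (i + j)) (length w)
    w≡ = trans e (trans (map-upTo _ (length w))
           (applyUpTo-cong (length w) (λ j< → uβ-at M (<-trans (+-monoʳ-< i j<) (length-φ^𝟎 M)))))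

  maximalPalindrome⇒MaxPal : ∀ {p} → MaximalPalindrome a b p → MaxPal p
  maximalPalindrome⇒MaxPal = MaximalPalindromeIn-transport (λ {w} → Factor⇒Occurs {w}) Occurs⇒Factor

  MaxPal⇒maximalPalindrome : ∀ {p} → MaxPal p → MaximalPalindrome a b p
  MaxPal⇒maximalPalindrome = MaximalPalindromeIn-transport Occurs⇒Factor (λ {w} → Factor⇒Occurs {w})

  -- Centres of the U⁽ⁿ⁾

  U-centralFactor : ∀ n {q} → HasCenter (U a b (suc n)) q → CentralFactor a b q (U a b (suc n))
  U-centralFactor n {q} (w , e) =
    w , Occurs⇒Factor (Occurs-⊑ ([] , q ++ reverse w , sym e) (proj₁ (proj₂ (U-maxPal n)))) , e

  unique-maxPal-with-centre : ∀ {c} m → (∀ n → n ≢ m → ¬ HasCenter (U a b (suc n)) c) →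
    ∀ p → MaximalPalindrome a b p → HasCenter p c → p ≡ U a b (suc m)
  unique-maxPal-with-centre m others p mp hp with n , refl ← maxPal⇒U (maximalPalindrome⇒MaxPal mp) with n ≟ m
  ... | yes refl = refl
  ... | no n≢m   = contradiction hp (others n n≢m)

  V-central : ∀ {m} → HasCenter (U a b (suc m)) (V a b 1) → ∀ n → HasCenter (U a b (suc (n + m))) (V a b (suc n))
  V-central h zero    = h
  V-central h (suc n) = T-centre (V-central h n)

  U₁-centre-odd : ¬ 2 ∣ a → HasCenter (U a b 1) ε
  U₁-centre-odd 2∤a = 𝟎^-centre-even (odd⇒2∣pred 2∤a)

  U₁-centre-even : 2 ∣ a → HasCenter (U a b 1) (𝟎 ∷ [])
  U₁-centre-even 2∣a = 𝟎^-centre-odd (λ 2∣a∸1 → 2∣n⇒2∤suc 2∣a∸1 (subst (2 ∣_) (sym 1+[a∸1]≡a) 2∣a))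

  part-i : 2 ∣ b → ¬ 2 ∣ a →
      ((n : ℕ) → 1 ≤ n → CentralFactor a b (V a b n) (U a b n))
    × ((n : ℕ) → 1 ≤ n → HasCenter (U a b (2 * n ∸ 1)) ε × HasCenter (U a b (2 * n)) (𝟏 ∷ []))
  part-i 2∣b 2∤a = central , centres
    where
    U₁⊇V₁ : HasCenter (U a b 1) (V a b 1)
    U₁⊇V₁ = 𝟎^-centre (<⇒≤ b<a∸1) (∣-∸ (<⇒≤ b<a∸1) (odd⇒2∣pred 2∤a) 2∣b)
    central : (n : ℕ) → 1 ≤ n → CentralFactor a b (V a b n) (U a b n)
    central (suc n) _ =
      U-centralFactor n (subst (λ k → HasCenter (U a b (suc k)) (V a b (suc n))) (+-identityʳ n) (V-central U₁⊇V₁ n))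
    period : ∀ k → HasCenter (U a b (1 + k * 2)) ε × HasCenter (U a b (2 + k * 2)) (𝟏 ∷ [])
    period zero    = U₁-centre-odd 2∤a , T-step-ε (U₁-centre-odd 2∤a)
    period (suc k) = h , T-step-ε h
      where h = T-step-letter (proj₂ (period k)) (𝟎^-centre-even 2∣b)
    centres : (n : ℕ) → 1 ≤ n → HasCenter (U a b (2 * n ∸ 1)) ε × HasCenter (U a b (2 * n)) (𝟏 ∷ [])
    centres (suc k) _ = subst (λ i → HasCenter (U a b (i ∸ 1)) ε × HasCenter (U a b i) (𝟏 ∷ [])) (*-comm (suc k) 2) (period k)

  part-ii : 2 ∣ b → 2 ∣ a →
      (MaximalPalindrome a b (U a b 1) × HasCenter (U a b 1) (𝟎 ∷ [])
        × ((p : List Letter) → MaximalPalindrome a b p → HasCenter p (𝟎 ∷ []) → p ≡ U a b 1))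
    × ((n : ℕ) → 1 ≤ n → CentralFactor a b (V a b n) (U a b (n + 1)))
    × ((n : ℕ) → 1 ≤ n → HasCenter (U a b (2 * n)) ε × HasCenter (U a b (2 * n + 1)) (𝟏 ∷ []))
  part-ii 2∣b 2∣a =
    (MaxPal⇒maximalPalindrome U₁-maxPal , U₁-centre-even 2∣a , unique-maxPal-with-centre 0 others) , central , centres
    where
    U₂ε : HasCenter (U a b 2) ε
    U₂ε = T-step-letter (U₁-centre-even 2∣a) (𝟎^-centre-even 2∣a)
    U≥2-centre : ∀ j → HasCenter (U a b (2 + j)) ε ⊎ HasCenter (U a b (2 + j)) (𝟏 ∷ [])
    U≥2-centre zero = inj₁ U₂ε
    U≥2-centre (suc j) with U≥2-centre j
    ... | inj₁ hε = inj₂ (T-step-ε hε)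
    ... | inj₂ h𝟏 = inj₁ (T-step-letter h𝟏 (𝟎^-centre-even 2∣b))
    others : ∀ n → n ≢ 0 → ¬ HasCenter (U a b (suc n)) (𝟎 ∷ [])
    others zero    0≢0 = contradiction refl 0≢0
    others (suc j) _ h𝟎 with U≥2-centre j
    ... | inj₁ hε = HasCenter-ε-letter hε h𝟎
    ... | inj₂ h𝟏 = 𝟎≢𝟏 (HasCenter-letter-unique h𝟎 h𝟏)
    U₂⊇V₁ : HasCenter (U a b 2) (V a b 1)
    U₂⊇V₁ = T-step-letter (U₁-centre-even 2∣a) (𝟎^-centre (<⇒≤ b<a) (∣-∸ (<⇒≤ b<a) 2∣a 2∣b))
    central : (n : ℕ) → 1 ≤ n → CentralFactor a b (V a b n) (U a b (n + 1))
    central (suc n) _ = U-centralFactor (n + 1) (V-central U₂⊇V₁ n)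
    period : ∀ k → HasCenter (U a b (2 + k * 2)) ε × HasCenter (U a b (3 + k * 2)) (𝟏 ∷ [])
    period zero    = U₂ε , T-step-ε U₂ε
    period (suc k) = h , T-step-ε h
      where h = T-step-letter (proj₂ (period k)) (𝟎^-centre-even 2∣b)
    centres : (n : ℕ) → 1 ≤ n → HasCenter (U a b (2 * n)) ε × HasCenter (U a b (2 * n + 1)) (𝟏 ∷ [])
    centres (suc k) _ =
      subst₂ (λ i j → HasCenter (U a b i) ε × HasCenter (U a b j) (𝟏 ∷ [])) 2+2k≡2[1+k] 3+2k≡2[1+k]+1 (period k)
      where
      2+2k≡2[1+k] : 2 + k * 2 ≡ 2 * suc k
      2+2k≡2[1+k] = *-comm (suc k) 2
      3+2k≡2[1+k]+1 : 3 + k * 2 ≡ 2 * suc k + 1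
      3+2k≡2[1+k]+1 = trans (+-comm 1 (2 + k * 2)) (cong (_+ 1) 2+2k≡2[1+k])

  part-iii : ¬ 2 ∣ b → 2 ∣ a →
      ((n : ℕ) → 1 ≤ n → CentralFactor a b (V a b n) (U a b n))
    × ((n : ℕ) → 1 ≤ n →
         HasCenter (U a b (3 * n ∸ 2)) (𝟎 ∷ []) × HasCenter (U a b (3 * n ∸ 1)) ε × HasCenter (U a b (3 * n)) (𝟏 ∷ []))
  part-iii 2∤b 2∣a = central , centres
    where
    U₁⊇V₁ : HasCenter (U a b 1) (V a b 1)
    U₁⊇V₁ = 𝟎^-centre (<⇒≤ b<a∸1) (subst (2 ∣_) (sym (∸-+-assoc a 1 b)) (∣-∸ b<a 2∣a (odd⇒2∣suc 2∤b)))
    central : (n : ℕ) → 1 ≤ n → CentralFactor a b (V a b n) (U a b n)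
    central (suc n) _ =
      U-centralFactor n (subst (λ k → HasCenter (U a b (suc k)) (V a b (suc n))) (+-identityʳ n) (V-central U₁⊇V₁ n))
    period : ∀ k →
      HasCenter (U a b (1 + k * 3)) (𝟎 ∷ []) × HasCenter (U a b (2 + k * 3)) ε × HasCenter (U a b (3 + k * 3)) (𝟏 ∷ [])
    period zero    = U₁-centre-even 2∣a , h , T-step-ε h
      where h = T-step-letter (U₁-centre-even 2∣a) (𝟎^-centre-even 2∣a)
    period (suc k) = h₁ , h₂ , T-step-ε h₂
      where
      h₁ = T-step-letter (proj₂ (proj₂ (period k))) (𝟎^-centre-odd 2∤b)
      h₂ = T-step-letter h₁ (𝟎^-centre-even 2∣a)
    centres : (n : ℕ) → 1 ≤ n →
      HasCenter (U a b (3 * n ∸ 2)) (𝟎 ∷ []) × HasCenter (U a b (3 * n ∸ 1)) ε × HasCenter (U a b (3 * n)) (𝟏 ∷ [])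
    centres (suc k) _ =
      subst (λ i → HasCenter (U a b (i ∸ 2)) (𝟎 ∷ []) × HasCenter (U a b (i ∸ 1)) ε × HasCenter (U a b i) (𝟏 ∷ []))
        (*-comm (suc k) 3) (period k)

  part-iv : ¬ 2 ∣ b → ¬ 2 ∣ a →
      (MaximalPalindrome a b (U a b 1) × HasCenter (U a b 1) ε
        × ((p : List Letter) → MaximalPalindrome a b p → HasCenter p ε → p ≡ U a b 1))
    × (MaximalPalindrome a b (U a b 2) × HasCenter (U a b 2) (𝟏 ∷ [])
        × ((p : List Letter) → MaximalPalindrome a b p → HasCenter p (𝟏 ∷ []) → p ≡ U a b 2))
    × ((n : ℕ) → 3 ≤ n → HasCenter (U a b n) (𝟎 ∷ []) × CentralFactor a b (V a b (n ∸ 2)) (U a b n))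
  part-iv 2∤b 2∤a =
      (MaxPal⇒maximalPalindrome U₁-maxPal , U₁ε , unique-maxPal-with-centre 0 others-ε)
    , (MaxPal⇒maximalPalindrome (U-maxPal 1) , U₂𝟏 , unique-maxPal-with-centre 1 others-𝟏)
    , beyond
    where
    U₁ε : HasCenter (U a b 1) ε
    U₁ε = U₁-centre-odd 2∤a
    U₂𝟏 : HasCenter (U a b 2) (𝟏 ∷ [])
    U₂𝟏 = T-step-ε U₁ε
    U≥3𝟎 : ∀ j → HasCenter (U a b (3 + j)) (𝟎 ∷ [])
    U≥3𝟎 zero    = T-step-letter U₂𝟏 (𝟎^-centre-odd 2∤b)
    U≥3𝟎 (suc j) = T-step-letter (U≥3𝟎 j) (𝟎^-centre-odd 2∤a)
    others-ε : ∀ n → n ≢ 0 → ¬ HasCenter (U a b (suc n)) ε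
    others-ε zero          0≢0 = contradiction refl 0≢0
    others-ε (suc zero)    _ hε = HasCenter-ε-letter hε U₂𝟏
    others-ε (suc (suc j)) _ hε = HasCenter-ε-letter hε (U≥3𝟎 j)
    others-𝟏 : ∀ n → n ≢ 1 → ¬ HasCenter (U a b (suc n)) (𝟏 ∷ [])
    others-𝟏 zero          _ h𝟏 = HasCenter-ε-letter U₁ε h𝟏
    others-𝟏 (suc zero)    1≢1 = contradiction refl 1≢1
    others-𝟏 (suc (suc j)) _ h𝟏 = 𝟎≢𝟏 (HasCenter-letter-unique (U≥3𝟎 j) h𝟏)
    U₃⊇V₁ : HasCenter (U a b 3) (V a b 1)
    U₃⊇V₁ = T-step-letter U₂𝟏 (HasCenter-refl (𝟎^ b))
    beyond : (n : ℕ) → 3 ≤ n → HasCenter (U a b n) (𝟎 ∷ []) × CentralFactor a b (V a b (n ∸ 2)) (U a b n)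
    beyond n 3≤n with j , refl ← m≤n⇒∃[o]m+o≡n 3≤n =
      U≥3𝟎 j , U-centralFactor (2 + j) (subst (λ i → HasCenter (U a b (suc i)) (V a b (suc j))) (+-comm j 2) (V-central U₃⊇V₁ j))

proposition5p13 : (a b : ℕ) → 1 ≤ b → b < a ∸ 1 →
  -- (i) b even, a odd
  ((2 ∣ b) → ¬ (2 ∣ a) →
    ((n : ℕ) → 1 ≤ n → CentralFactor a b (V a b n) (U a b n))
    × ((n : ℕ) → 1 ≤ n →
        HasCenter (U a b (2 * n ∸ 1)) ε × HasCenter (U a b (2 * n)) (𝟏 ∷ [])))
  ×
  -- (ii) a, b even
  ((2 ∣ b) → (2 ∣ a) →
    (MaximalPalindrome a b (U a b 1) × HasCenter (U a b 1) (𝟎 ∷ [])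
      × ((p : List Letter) → MaximalPalindrome a b p → HasCenter p (𝟎 ∷ []) → p ≡ U a b 1))
    × ((n : ℕ) → 1 ≤ n → CentralFactor a b (V a b n) (U a b (n + 1)))
    × ((n : ℕ) → 1 ≤ n →
        HasCenter (U a b (2 * n)) ε × HasCenter (U a b (2 * n + 1)) (𝟏 ∷ [])))
  ×
  -- (iii) b odd, a even
  (¬ (2 ∣ b) → (2 ∣ a) →
    ((n : ℕ) → 1 ≤ n → CentralFactor a b (V a b n) (U a b n))
    × ((n : ℕ) → 1 ≤ n →
        HasCenter (U a b (3 * n ∸ 2)) (𝟎 ∷ [])
        × HasCenter (U a b (3 * n ∸ 1)) ε
        × HasCenter (U a b (3 * n)) (𝟏 ∷ [])))
  ×
  -- (iv) a, b odd
  (¬ (2 ∣ b) → ¬ (2 ∣ a) →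
    (MaximalPalindrome a b (U a b 1) × HasCenter (U a b 1) ε
      × ((p : List Letter) → MaximalPalindrome a b p → HasCenter p ε → p ≡ U a b 1))
    × (MaximalPalindrome a b (U a b 2) × HasCenter (U a b 2) (𝟏 ∷ [])
      × ((p : List Letter) → MaximalPalindrome a b p → HasCenter p (𝟏 ∷ []) → p ≡ U a b 2))
    × ((n : ℕ) → 3 ≤ n →
        HasCenter (U a b n) (𝟎 ∷ []) × CentralFactor a b (V a b (n ∸ 2)) (U a b n)))
proposition5p13 a b 1≤b b<a∸1 = part-i , part-ii , part-iii , part-iv
  where open Fixpoint a b 1≤b b<a∸1
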